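{- Let $p\le q$ be positive integers. The complete bipartite graph $K_{p,q}$ is a TRVG with respect to the torus if and only if $p\le 2$ or $(p,q)\in\{(3,3),(3,4),(3,5),(3,6),(4,4)\}$.
   Context: The torus is the flat torus obtained from an axis-parallel rectangle in the plane by identifying opposite sides; horizontal and vertical lines in it are closed loops (wrapping around). A graph $G$ is a TRVG with respect to the torus if there is a collection of axis-parallel rectangles in the torus with pairwise disjoint interiors, one rectangle $R_v$ per vertex $v$, such that distinct vertices $u,v$ are adjacent if and only if some horizontal or vertical line (loop) of the torus meets the interiors of both $R_u$ and $R_v$ (other rectangles do not block visibility).
   Formalization: The side lengths of the torus and the corner coordinates, widths and heights of all rectangles are taken in the rationals. -}

module Defs where

open import Data.Nat using (ℕ)
open import Data.Integer using (ℤ; +_)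
open import Data.Rational using (ℚ; _<_; _+_; _*_; _/_; 0ℚ)
open import Data.Fin using (Fin)
open import Data.Sum using (_⊎_; inj₁; inj₂)
open import Data.Product using (Σ; _×_; ∃)
open import Data.Unit using (⊤)
open import Data.Empty using (⊥)
open import Relation.Nullary using (¬_)
open import Relation.Binary.PropositionalEquality using (_≡_)
open import Function.Bundles using (_⇔_)

ℤ→ℚ : ℤ → ℚ
ℤ→ℚ k = k / 1

-- The circle ℚ / Lℤ of length L.  A real number c (given by any representative)
-- lies in the open arc starting at a of length ℓ iff some translate c + kL
-- lies in the open interval (a , a + ℓ).
InArc : (L a ℓ c : ℚ) → Set
InArc L a ℓ c = Σ ℤ λ k → (a < c + ℤ→ℚ k * L) × (c + ℤ→ℚ k * L < a + ℓ)

-- An axis-parallel rectangle in the flat torus of width W and height H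
-- (quotient of the plane by Wℤ × Hℤ): lower-left corner (x , y) (any
-- representative), width w and height h, with 0 < w < W and 0 < h < H so that
-- the open interior is embedded.
record Rect (W H : ℚ) : Set where
  field
    x y w h : ℚ
    0<w : 0ℚ < w
    w<W : w < W
    0<h : 0ℚ < h
    h<H : h < H
open Rect public

InInterior : ∀ {W H} → Rect W H → ℚ → ℚ → Set
InInterior {W} {H} R c d = InArc W (x R) (w R) c × InArc H (y R) (h R) d

HorizMeets : ∀ {W H} → Rect W H → ℚ → Set
HorizMeets {W} {H} R d = InArc H (y R) (h R) d

VertMeets : ∀ {W H} → Rect W H → ℚ → Set
VertMeets {W} {H} R c = InArc W (x R) (w R) c

DisjointInteriors : ∀ {W H} → Rect W H → Rect W H → Set
DisjointInteriors R S = ∀ c d → ¬ (InInterior R c d × InInterior S c d)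

Visible : ∀ {W H} → Rect W H → Rect W H → Set
Visible R S = (∃ λ d → HorizMeets R d × HorizMeets S d)
            ⊎ (∃ λ c → VertMeets R c × VertMeets S c)

IsTRVG : (V : Set) → (V → V → Set) → Set
IsTRVG V E =
  Σ ℚ λ W → Σ ℚ λ H → (0ℚ < W) × (0ℚ < H) ×
  Σ (V → Rect W H) λ R →
    (∀ u v → ¬ u ≡ v → DisjointInteriors (R u) (R v)) ×
    (∀ u v → ¬ u ≡ v → (E u v ⇔ Visible (R u) (R v)))

KAdj : (p q : ℕ) → Fin p ⊎ Fin q → Fin p ⊎ Fin q → Set
KAdj p q (inj₁ _) (inj₂ _) = ⊤
KAdj p q (inj₂ _) (inj₁ _) = ⊤
KAdj p q (inj₁ _) (inj₁ _) = ⊥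
KAdj p q (inj₂ _) (inj₂ _) = ⊥

K : (p q : ℕ) → Set
K p q = IsTRVG (Fin p ⊎ Fin q) (KAdj p q)

{-# OPTIONS --safe #-}
module Submission where

-- If a loop meets two open arcs of a circle, the start of one of the arcs lies in the half-open
-- range of the other; conversely, two arcs whose half-open ranges contain a common start share a
-- loop. So in a torus layout of K_{p,q} every edge can be labelled by the direction of a loop seeing
-- both ends and by the end whose rectangle starts inside the other's range. Two edges with the same
-- label would make two rectangles of the same colour class visible to each other, so the labelling
-- is injective: pq ≤ 2(p + q), i.e. (p - 2)q ≤ 2p, which leaves exactly the listed cases.
-- Conversely, K_{2,n} is realised by a horizontal and a vertical bar together with n unit cells on
-- the diagonal, K_{3,6} and K_{4,4} by explicit integer layouts checked by a decision procedure, and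
-- the remaining graphs are induced subgraphs of these.

open import Defs
open import Data.Nat using (ℕ; _≤_)
open import Data.Sum using (_⊎_)
open import Data.Product using (_×_)
open import Relation.Binary.PropositionalEquality using (_≡_)
open import Function.Bundles using (_⇔_)

open import Data.Nat using (zero; suc; z≤n; s≤s)
import Data.Nat as ℕ
import Data.Nat.Properties as ℕ
open import Data.Integer as ℤ using (ℤ; +_; -[1+_]; +[1+_])
import Data.Integer.Properties as ℤ
open import Data.Rational as ℚ using (ℚ; mkℚ; 0ℚ; 1ℚ)
import Data.Rational.Properties as ℚ
open import Data.Rational.Solver using (module +-*-Solver)
import Data.Nat.Coprimality as Coprime
open import Data.Fin using (Fin; zero; suc; toℕ; inject≤)
import Data.Fin.Properties as Fin
open import Data.Sum using (inj₁; inj₂; [_,_])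
import Data.Sum as Sum
import Data.Sum.Properties as Sum
open import Data.Product using (Σ; ∃; _,_; proj₁; proj₂)
open import Data.Unit using (tt)
open import Data.Empty using (⊥-elim)
open import Function using (_∘_; Injective)
open import Function.Bundles using (_↔_; _↣_; mk↣; mk↔ₛ′; mk⇔; Injection; Equivalence)
open import Function.Properties.Inverse using (↔⇒↣)
open import Function.Construct.Composition using (_↣-∘_; _↔-∘_; _⇔-∘_)
open import Function.Construct.Symmetry using (↔-sym)
open import Function.Construct.Identity using (⇔-id)
open import Data.Product.Function.NonDependent.Propositional using (_×-↔_)
open import Relation.Binary.PropositionalEquality using (refl; sym; trans; cong; cong₂; subst; subst₂; _≢_)
open import Relation.Binary using (Decidable; DecidableEquality)
open import Relation.Nullary using (¬_; Dec; yes; no)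
open import Relation.Nullary.Decidable using (decidable-stable; from-yes; _×-dec_; _⊎-dec_; _→-dec_; ¬?; map′)

module _ where
  open import Data.Rational using (_+_; _-_; _*_; -_; _<_)
  open +-*-Solver

  ℤ→ℚ-mkℚ : ∀ k → ℤ→ℚ k ≡ mkℚ k 0 (Coprime.sym (Coprime.1-coprimeTo _))
  ℤ→ℚ-mkℚ k = ℚ.fromℚᵘ-toℚᵘ (mkℚ k 0 _)

  ℤ→ℚ-+ : ∀ a b → ℤ→ℚ (a ℤ.+ b) ≡ ℤ→ℚ a + ℤ→ℚ b
  ℤ→ℚ-+ a b rewrite ℤ→ℚ-mkℚ a | ℤ→ℚ-mkℚ b =
    sym (cong₂ (λ u v → (u ℤ.+ v) ℚ./ 1) (ℤ.*-identityʳ a) (ℤ.*-identityʳ b))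

  ℤ→ℚ-neg : ∀ a → ℤ→ℚ (ℤ.- a) ≡ - ℤ→ℚ a
  ℤ→ℚ-neg (+ 0) = refl
  ℤ→ℚ-neg +[1+ n ] rewrite ℤ→ℚ-mkℚ +[1+ n ] = refl
  ℤ→ℚ-neg -[1+ n ] rewrite ℤ→ℚ-mkℚ +[1+ n ] = refl

  ℤ→ℚ-sub : ∀ a b → ℤ→ℚ (a ℤ.- b) ≡ ℤ→ℚ a - ℤ→ℚ b
  ℤ→ℚ-sub a b = trans (ℤ→ℚ-+ a (ℤ.- b)) (cong (λ t → ℤ→ℚ a + t) (ℤ→ℚ-neg b))

  ℤ→ℚ-cancel-< : ∀ {a b} → ℤ→ℚ a < ℤ→ℚ b → a ℤ.< b
  ℤ→ℚ-cancel-< {a} {b} a<b rewrite ℤ→ℚ-mkℚ a | ℤ→ℚ-mkℚ b with a<b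
  ... | ℚ.*<* a*1<b*1 = subst₂ ℤ._<_ (ℤ.*-identityʳ a) (ℤ.*-identityʳ b) a*1<b*1

  ℤ→ℚ-mono-≤ : ∀ {a b} → a ℤ.≤ b → ℤ→ℚ a ℚ.≤ ℤ→ℚ b
  ℤ→ℚ-mono-≤ {a} {b} a≤b rewrite ℤ→ℚ-mkℚ a | ℤ→ℚ-mkℚ b =
    ℚ.*≤* (subst₂ ℤ._≤_ (sym (ℤ.*-identityʳ a)) (sym (ℤ.*-identityʳ b)) a≤b)

  ℤ→ℚ-mono-< : ∀ {a b} → a ℤ.< b → ℤ→ℚ a < ℤ→ℚ b
  ℤ→ℚ-mono-< {a} {b} a<b rewrite ℤ→ℚ-mkℚ a | ℤ→ℚ-mkℚ b =
    ℚ.*<* (subst₂ ℤ._<_ (sym (ℤ.*-identityʳ a)) (sym (ℤ.*-identityʳ b)) a<b)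

  ℕ→ℚ : ℕ → ℚ
  ℕ→ℚ n = ℤ→ℚ (+ n)

  ℕ→ℚ-+ : ∀ m n → ℕ→ℚ (m ℕ.+ n) ≡ ℕ→ℚ m + ℕ→ℚ n
  ℕ→ℚ-+ m n = ℤ→ℚ-+ (+ m) (+ n)

  ℕ→ℚ-mono-≤ : ∀ {m n} → m ≤ n → ℕ→ℚ m ℚ.≤ ℕ→ℚ n
  ℕ→ℚ-mono-≤ = ℤ→ℚ-mono-≤ ∘ ℤ.+≤+

  ℕ→ℚ-mono-< : ∀ {m n} → m ℕ.< n → ℕ→ℚ m < ℕ→ℚ n
  ℕ→ℚ-mono-< = ℤ→ℚ-mono-< ∘ ℤ.+<+

  p<q⇒0<q-p : ∀ {p q} → p < q → 0ℚ < q - p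
  p<q⇒0<q-p {p} {q} p<q = subst (_< q - p) (ℚ.+-inverseʳ p) (ℚ.+-monoˡ-< (- p) p<q)

  q<p+r⇒q-p<r : ∀ {p q r} → q < p + r → q - p < r
  q<p+r⇒q-p<r {p} {q} {r} q<p+r =
    subst (q - p <_) (solve 2 (λ p r → (p :+ r) :- p := r) refl p r) (ℚ.+-monoˡ-< (- p) q<p+r)

  p+r≤q⇒p≤q-r : ∀ {p q r} → p + r ℚ.≤ q → p ℚ.≤ q - r
  p+r≤q⇒p≤q-r {p} {q} {r} p+r≤q =
    subst (ℚ._≤ q - r) (solve 2 (λ p r → (p :+ r) :- r := p) refl p r) (ℚ.+-monoˡ-≤ (- r) p+r≤q)

  translate-difference : ∀ L c k j → (c + ℤ→ℚ j * L) - (c + ℤ→ℚ k * L) ≡ ℤ→ℚ (j ℤ.- k) * L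
  translate-difference L c k j rewrite ℤ→ℚ-sub j k =
    solve 4 (λ L c k j → (c :+ j :* L) :- (c :+ k :* L) := (j :- k) :* L) refl L c (ℤ→ℚ k) (ℤ→ℚ j)

  flip-multiple : ∀ L k j → ℤ→ℚ (k ℤ.- j) * L ≡ - (ℤ→ℚ (j ℤ.- k) * L)
  flip-multiple L k j rewrite ℤ→ℚ-sub k j | ℤ→ℚ-sub j k =
    solve 3 (λ L k j → (k :- j) :* L := :- ((j :- k) :* L)) refl L (ℤ→ℚ k) (ℤ→ℚ j)

  ¬0<kL<L : ∀ {L} k → 0ℚ < L → 0ℚ < ℤ→ℚ k * L → ¬ (ℤ→ℚ k * L < L)
  ¬0<kL<L {L} k 0<L 0<kL kL<L = no-integer-strictly-between-0-and-1 k
    (ℤ→ℚ-cancel-< (ℚ.*-cancelʳ-<-nonNeg L (subst (_< ℤ→ℚ k * L) (sym (ℚ.*-zeroˡ L)) 0<kL)))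
    (ℤ→ℚ-cancel-< (ℚ.*-cancelʳ-<-nonNeg L (subst (ℤ→ℚ k * L <_) (sym (ℚ.*-identityˡ L)) kL<L)))
    where
    instance
      L≥0 : ℚ.NonNegative L
      L≥0 = ℚ.pos⇒nonNeg L {{ℚ.positive 0<L}}
    no-integer-strictly-between-0-and-1 : ∀ k → + 0 ℤ.< k → ¬ (k ℤ.< + 1)
    no-integer-strictly-between-0-and-1 (+ 0) (ℤ.+<+ ()) _
    no-integer-strictly-between-0-and-1 +[1+ n ] _ (ℤ.+<+ (s≤s ()))

  precedes⇒disjoint : ∀ {L a ℓ b m} → 0ℚ < L → a + ℓ ℚ.≤ b → b + m ℚ.≤ a + L →
                      ∀ c → ¬ (InArc L a ℓ c × InArc L b m c)
  precedes⇒disjoint {L} {a} {ℓ} {b} {m} 0<L aℓ≤b bm≤aL c ((k , a<u , u<aℓ) , (j , b<v , v<bm)) =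
    ¬0<kL<L (j ℤ.- k) 0<L
      (subst (0ℚ <_) (translate-difference L c k j) (p<q⇒0<q-p u<v))
      (subst (_< L) (translate-difference L c k j) (q<p+r⇒q-p<r v<u+L))
    where
    u = c + ℤ→ℚ k * L
    v = c + ℤ→ℚ j * L
    u<v : u < v
    u<v = ℚ.<-trans u<aℓ (ℚ.≤-<-trans aℓ≤b b<v)
    v<u+L : v < u + L
    v<u+L = ℚ.<-trans v<bm (ℚ.≤-<-trans bm≤aL (ℚ.+-monoˡ-< L a<u))

  InHalfOpenArc : (L b m a : ℚ) → Set
  InHalfOpenArc L b m a = Σ ℤ λ k → (b ℚ.≤ a + ℤ→ℚ k * L) × (a + ℤ→ℚ k * L < b + m)

  start-within-self : ∀ {L a ℓ} → 0ℚ < ℓ → InHalfOpenArc L a ℓ a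
  start-within-self {L} {a} {ℓ} 0<ℓ = + 0 , ℚ.≤-reflexive (sym a+0L≡a) ,
    subst (_< a + ℓ) (sym a+0L≡a) (subst (_< a + ℓ) (ℚ.+-identityʳ a) (ℚ.+-monoʳ-< a 0<ℓ))
    where
    a+0L≡a : a + 0ℚ * L ≡ a
    a+0L≡a = trans (cong (λ t → a + t) (ℚ.*-zeroˡ L)) (ℚ.+-identityʳ a)

  translated-start-within : ∀ {L a b m c} k j → a < c + ℤ→ℚ k * L → c + ℤ→ℚ j * L < b + m →
                 b ℚ.≤ a + ℤ→ℚ (j ℤ.- k) * L → InHalfOpenArc L b m a
  translated-start-within {L} {a} {b} {m} {c} k j a<u v<bm b≤ = j ℤ.- k , b≤ , ℚ.<-trans a+δ<v v<bm
    where
    u = c + ℤ→ℚ k * L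
    v = c + ℤ→ℚ j * L
    a+δ<v : a + ℤ→ℚ (j ℤ.- k) * L < v
    a+δ<v = subst₂ _<_ (cong (λ δ → a + δ) (translate-difference L c k j))
                       (solve 2 (λ u v → u :+ (v :- u) := v) refl u v)
                       (ℚ.+-monoˡ-< (v - u) a<u)

  common-point⇒start-within : ∀ {L a ℓ b m c} → InArc L a ℓ c → InArc L b m c →
                              InHalfOpenArc L b m a ⊎ InHalfOpenArc L a ℓ b
  common-point⇒start-within {L} {a} {ℓ} {b} {m} {c} (k , a<u , u<aℓ) (j , b<v , v<bm)
    with ℚ.≤-total b (a + ℤ→ℚ (j ℤ.- k) * L)
  ... | inj₁ b≤a+δ = inj₁ (translated-start-within {c = c} k j a<u v<bm b≤a+δ)
  ... | inj₂ a+δ≤b = inj₂ (translated-start-within {c = c} j k b<v u<aℓ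
    (subst (λ δ → a ℚ.≤ b + δ) (sym (flip-multiple L k j)) (p+r≤q⇒p≤q-r a+δ≤b)))

  nudge-into-arc : ∀ {L b m a ε} k → b ℚ.≤ a + ℤ→ℚ k * L →
                   0ℚ < ε → ε < (b + m) - (a + ℤ→ℚ k * L) →
          InArc L b m (a + ε)
  nudge-into-arc {L} {b} {m} {a} {ε} k b≤u 0<ε ε<d = k ,
    subst (b <_) (sym shift)
      (ℚ.≤-<-trans b≤u (subst (_< u + ε) (ℚ.+-identityʳ u) (ℚ.+-monoʳ-< u 0<ε))) ,
    subst (_< b + m) (sym shift)
      (subst (u + ε <_) (solve 2 (λ u x → u :+ (x :- u) := x) refl u (b + m)) (ℚ.+-monoʳ-< u ε<d))
    where
    u = a + ℤ→ℚ k * L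
    shift : (a + ε) + ℤ→ℚ k * L ≡ u + ε
    shift = solve 3 (λ a ε kL → (a :+ ε) :+ kL := (a :+ kL) :+ ε) refl a ε (ℤ→ℚ k * L)

  start-within⇒common-point : ∀ {L a b m b′ m′} → InHalfOpenArc L b m a → InHalfOpenArc L b′ m′ a →
                              ∃ λ c → InArc L b m c × InArc L b′ m′ c
  start-within⇒common-point {L} {a} {b} {m} {b′} {m′} (k , b≤u , u<bm) (j , b′≤v , v<b′m′) =
    let ε , 0<ε , ε<d⊓d′ = ℚ.<-dense 0<d⊓d′ in
    a + ε , nudge-into-arc {L} {a = a} k b≤u 0<ε (ℚ.<-≤-trans ε<d⊓d′ (ℚ.p⊓q≤p d d′)) ,
            nudge-into-arc {L} {a = a} j b′≤v 0<ε (ℚ.<-≤-trans ε<d⊓d′ (ℚ.p⊓q≤q d d′))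
    where
    d = (b + m) - (a + ℤ→ℚ k * L)
    d′ = (b′ + m′) - (a + ℤ→ℚ j * L)
    0<d⊓d′ : 0ℚ < d ℚ.⊓ d′
    0<d⊓d′ with ℚ.⊓-sel d d′
    ... | inj₁ d⊓d′≡d = subst (0ℚ <_) (sym d⊓d′≡d) (p<q⇒0<q-p u<bm)
    ... | inj₂ d⊓d′≡d′ = subst (0ℚ <_) (sym d⊓d′≡d′) (p<q⇒0<q-p v<b′m′)

data Axis : Set where
  horizontal vertical : Axis

2↔Axis : Fin 2 ↔ Axis
2↔Axis = mk↔ₛ′ to from to∘from from∘to
  where
  to : Fin 2 → Axis
  to zero = horizontal
  to (suc zero) = vertical
  from : Axis → Fin 2
  from horizontal = zero
  from vertical = suc zero
  to∘from : ∀ a → to (from a) ≡ a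
  to∘from horizontal = refl
  to∘from vertical = refl
  from∘to : ∀ i → from (to i) ≡ i
  from∘to zero = refl
  from∘to (suc zero) = refl

module _ {W H : ℚ} where

  period : Axis → ℚ
  period horizontal = H
  period vertical = W

  start extent : Axis → Rect W H → ℚ
  start horizontal R = y R
  start vertical R = x R
  extent horizontal R = h R
  extent vertical R = w R

  SeenAlong : Axis → Rect W H → Rect W H → Set
  SeenAlong a R S = ∃ λ c → InArc (period a) (start a R) (extent a R) c
                          × InArc (period a) (start a S) (extent a S) c

  visible⇒seenAlong : ∀ {R S} → Visible R S → Σ Axis λ a → SeenAlong a R S
  visible⇒seenAlong (inj₁ seen) = horizontal , seen
  visible⇒seenAlong (inj₂ seen) = vertical , seen

  seenAlong⇒visible : ∀ {R S} a → SeenAlong a R S → Visible R S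
  seenAlong⇒visible horizontal = inj₁
  seenAlong⇒visible vertical = inj₂

  Anchored : Axis → Rect W H → Rect W H → Set
  Anchored a R S = InHalfOpenArc (period a) (start a S) (extent a S) (start a R)

  seenAlong⇒anchored : ∀ a {R S} → SeenAlong a R S → Anchored a R S ⊎ Anchored a S R
  seenAlong⇒anchored a {R} (c , c∈R , c∈S) =
    common-point⇒start-within {period a} {start a R} {c = c} c∈R c∈S

  anchored⇒seenAlong : ∀ a {R S S′} → Anchored a R S → Anchored a R S′ → SeenAlong a S S′
  anchored⇒seenAlong a {R} = start-within⇒common-point {period a} {start a R}

module _ {W H : ℚ} {p q : ℕ} (A : Fin p → Rect W H) (B : Fin q → Rect W H)
         (A-sees-B : ∀ i j → Visible (A i) (B j))
         (A-blind : ∀ {i i′} → Visible (A i) (A i′) → i ≡ i′)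
         (B-blind : ∀ {j j′} → Visible (B j) (B j′) → j ≡ j′) where

  open import Data.Nat using (_+_; _*_)

  Anchor : Fin p × Fin q → Axis × (Fin p ⊎ Fin q) → Set
  Anchor (i , j) (a , inj₁ i′) = i′ ≡ i × Anchored a (A i) (B j)
  Anchor (i , j) (a , inj₂ j′) = j′ ≡ j × Anchored a (B j) (A i)

  anchor : ∀ e → Σ _ (Anchor e)
  anchor (i , j) with visible⇒seenAlong (A-sees-B i j)
  ... | a , seen with seenAlong⇒anchored a seen
  ...   | inj₁ A-in-B = (a , inj₁ i) , refl , A-in-B
  ...   | inj₂ B-in-A = (a , inj₂ j) , refl , B-in-A

  anchor-determines-edge : ∀ {e e′ t} → Anchor e t → Anchor e′ t → e ≡ e′
  anchor-determines-edge {i , _} {_ , _} {a , inj₁ _} (refl , A-in-B) (refl , A-in-B′) =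
    cong (i ,_) (B-blind (seenAlong⇒visible a (anchored⇒seenAlong a A-in-B A-in-B′)))
  anchor-determines-edge {_ , j} {_ , _} {a , inj₂ _} (refl , B-in-A) (refl , B-in-A′) =
    cong (_, j) (A-blind (seenAlong⇒visible a (anchored⇒seenAlong a B-in-A B-in-A′)))

  anchor-injective : Injective _≡_ _≡_ (proj₁ ∘ anchor)
  anchor-injective {e} {e′} same =
    anchor-determines-edge (subst (Anchor e) same (proj₂ (anchor e))) (proj₂ (anchor e′))

  biclique-bound : p * q ≤ 2 * (p + q)
  biclique-bound = Fin.injective⇒≤ (Injection.injective edges↣anchors)
    where
    edges↣anchors : Fin (p * q) ↣ Fin (2 * (p + q))
    edges↣anchors =
      ↔⇒↣ (↔-sym ((2↔Axis ×-↔ Fin.+↔⊎) ↔-∘ Fin.*↔×)) ↣-∘ (mk↣ anchor-injective ↣-∘ ↔⇒↣ Fin.*↔×)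

K⇒biclique-bound : ∀ {p q} → K p q → p ℕ.* q ≤ 2 ℕ.* (p ℕ.+ q)
K⇒biclique-bound (_ , _ , _ , _ , R , _ , adjacent⇔visible) =
  biclique-bound (R ∘ inj₁) (R ∘ inj₂) sees blind₁ blind₂
  where
  sees : ∀ i j → Visible (R (inj₁ i)) (R (inj₂ j))
  sees i j = Equivalence.to (adjacent⇔visible (inj₁ i) (inj₂ j) λ ()) tt
  blind₁ : ∀ {i i′} → Visible (R (inj₁ i)) (R (inj₁ i′)) → i ≡ i′
  blind₁ {i} {i′} seen = decidable-stable (i Fin.≟ i′) λ i≢i′ →
    Equivalence.from (adjacent⇔visible (inj₁ i) (inj₁ i′) (i≢i′ ∘ Sum.inj₁-injective)) seen
  blind₂ : ∀ {j j′} → Visible (R (inj₂ j)) (R (inj₂ j′)) → j ≡ j′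
  blind₂ {j} {j′} seen = decidable-stable (j Fin.≟ j′) λ j≢j′ →
    Equivalence.from (adjacent⇔visible (inj₂ j) (inj₂ j′) (j≢j′ ∘ Sum.inj₂-injective)) seen

module _ where
  open import Data.Nat using (_+_; _*_; _∸_)
  open ℕ.≤-Reasoning

  Admissible : ℕ → ℕ → Set
  Admissible p q = p ≤ 2 ⊎ (p ≡ 3 × q ≡ 3) ⊎ (p ≡ 3 × q ≡ 4) ⊎ (p ≡ 3 × q ≡ 5)
                         ⊎ (p ≡ 3 × q ≡ 6) ⊎ (p ≡ 4 × q ≡ 4)

  excess-bound : ∀ p q → p * q ≤ 2 * (p + q) → (p ∸ 2) * q ≤ 2 * p
  excess-bound p q pq≤2[p+q] = begin
    (p ∸ 2) * q            ≡⟨ ℕ.*-distribʳ-∸ q p 2 ⟩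
    p * q ∸ 2 * q          ≤⟨ ℕ.∸-monoˡ-≤ (2 * q) pq≤2[p+q] ⟩
    2 * (p + q) ∸ 2 * q    ≡⟨ cong (_∸ 2 * q) (ℕ.*-distribˡ-+ 2 p q) ⟩
    2 * p + 2 * q ∸ 2 * q  ≡⟨ ℕ.m+n∸n≡m (2 * p) (2 * q) ⟩
    2 * p                  ∎

  excess-bound⇒admissible : ∀ {p q} → 1 ≤ p → p ≤ q → (p ∸ 2) * q ≤ 2 * p → Admissible p q
  excess-bound⇒admissible {1} _ _ _ = inj₁ (s≤s z≤n)
  excess-bound⇒admissible {2} _ _ _ = inj₁ (s≤s (s≤s z≤n))
  excess-bound⇒admissible {3} _ 3≤q q≤6 = p≡3 3≤q (subst (_≤ 6) (ℕ.*-identityˡ _) q≤6)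
    where
    p≡3 : ∀ {q} → 3 ≤ q → q ≤ 6 → Admissible 3 q
    p≡3 (s≤s (s≤s (s≤s z≤n))) (s≤s (s≤s (s≤s z≤n))) = inj₂ (inj₁ (refl , refl))
    p≡3 (s≤s (s≤s (s≤s z≤n))) (s≤s (s≤s (s≤s (s≤s z≤n)))) = inj₂ (inj₂ (inj₁ (refl , refl)))
    p≡3 (s≤s (s≤s (s≤s z≤n))) (s≤s (s≤s (s≤s (s≤s (s≤s z≤n))))) =
      inj₂ (inj₂ (inj₂ (inj₁ (refl , refl))))
    p≡3 (s≤s (s≤s (s≤s z≤n))) (s≤s (s≤s (s≤s (s≤s (s≤s (s≤s z≤n)))))) =
      inj₂ (inj₂ (inj₂ (inj₂ (inj₁ (refl , refl)))))
  excess-bound⇒admissible {4} {q} _ 4≤q 2q≤8 =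
    inj₂ (inj₂ (inj₂ (inj₂ (inj₂ (refl , ℕ.≤-antisym (ℕ.*-cancelˡ-≤ {q} {4} 2 2q≤8) 4≤q)))))
  excess-bound⇒admissible {suc (suc (suc (suc (suc s))))} {suc q} _ p≤q excess
    with ℕ.*-cancelʳ-≤ 3 2 (suc q) 3q≤2q
    where
    3q≤2q : 3 * suc q ≤ 2 * suc q
    3q≤2q = begin
      3 * suc q        ≤⟨ ℕ.*-monoˡ-≤ (suc q) (ℕ.m≤m+n 3 s) ⟩
      (3 + s) * suc q  ≤⟨ excess ⟩
      2 * (5 + s)      ≤⟨ ℕ.*-monoʳ-≤ 2 p≤q ⟩
      2 * suc q        ∎
  ... | s≤s (s≤s ())

IsTRVG-induced : ∀ {V V′ : Set} {E : V → V → Set} {E′ : V′ → V′ → Set} (g : V′ → V) →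
                 Injective _≡_ _≡_ g → (∀ u v → E′ u v ⇔ E (g u) (g v)) →
                 IsTRVG V E → IsTRVG V′ E′
IsTRVG-induced g g-injective E′⇔E (W , H , 0<W , 0<H , R , disjoint , E⇔visible) =
  W , H , 0<W , 0<H , R ∘ g ,
  (λ u v u≢v → disjoint (g u) (g v) (u≢v ∘ g-injective)) ,
  (λ u v u≢v → E⇔visible (g u) (g v) (u≢v ∘ g-injective) ⇔-∘ E′⇔E u v)

K-mono : ∀ {p q p′ q′} → p′ ≤ p → q′ ≤ q → K p q → K p′ q′
K-mono {p} {q} {p′} {q′} p′≤p q′≤q = IsTRVG-induced embed embed-injective adjacency
  where
  embed : Fin p′ ⊎ Fin q′ → Fin p ⊎ Fin q
  embed = Sum.map (λ i → inject≤ i p′≤p) (λ j → inject≤ j q′≤q)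
  embed-injective : Injective _≡_ _≡_ embed
  embed-injective {inj₁ i} {inj₁ i′} same =
    cong inj₁ (Fin.inject≤-injective p′≤p p′≤p i i′ (Sum.inj₁-injective same))
  embed-injective {inj₂ j} {inj₂ j′} same =
    cong inj₂ (Fin.inject≤-injective q′≤q q′≤q j j′ (Sum.inj₂-injective same))
  adjacency : ∀ u v → KAdj p′ q′ u v ⇔ KAdj p q (embed u) (embed v)
  adjacency (inj₁ _) (inj₁ _) = ⇔-id _
  adjacency (inj₁ _) (inj₂ _) = ⇔-id _
  adjacency (inj₂ _) (inj₁ _) = ⇔-id _
  adjacency (inj₂ _) (inj₂ _) = ⇔-id _

record Arc : Set where
  constructor arc
  field
    pos len : ℕ
open Arc

module _ (L : ℕ) where
  open import Data.Nat using (_+_; _<_)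
  open import Data.Nat.Properties using (_≤?_; _<?_)

  Precedes : Arc → Arc → Set
  Precedes α β = pos α + len α ≤ pos β × pos β + len β ≤ pos α + L

  Apart : Arc → Arc → Set
  Apart α β = Precedes α β ⊎ Precedes β α

  -- Only the representatives c and c + L are tried: a sound test, complete for positions below L.
  Covers : Arc → ℕ → Set
  Covers α c = (pos α ≤ c × c < pos α + len α) ⊎ (pos α ≤ c + L × c + L < pos α + len α)

  Overlap : Arc → Arc → Set
  Overlap α β = Covers α (pos β) ⊎ Covers β (pos α)

  Proper : Arc → Set
  Proper α = 0 < len α × len α < L

  OnArc : Arc → ℚ → Set
  OnArc α = InArc (ℕ→ℚ L) (ℕ→ℚ (pos α)) (ℕ→ℚ (len α))

  apart? : ∀ α β → Dec (Apart α β)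
  apart? α β = precedes? α β ⊎-dec precedes? β α
    where
    precedes? : ∀ α β → Dec (Precedes α β)
    precedes? α β = (pos α + len α ≤? pos β) ×-dec (pos β + len β ≤? pos α + L)

  overlap? : ∀ α β → Dec (Overlap α β)
  overlap? α β = covers? α (pos β) ⊎-dec covers? β (pos α)
    where
    covers? : ∀ α c → Dec (Covers α c)
    covers? α c = ((pos α ≤? c) ×-dec (c <? pos α + len α))
            ⊎-dec ((pos α ≤? c + L) ×-dec (c + L <? pos α + len α))

  proper? : ∀ α → Dec (Proper α)
  proper? α = (0 <? len α) ×-dec (len α <? L)

  precedes⇒no-common-point : ∀ {α β} → 0 < L → Precedes α β → ∀ c → ¬ (OnArc α c × OnArc β c)
  precedes⇒no-common-point {α} {β} 0<L (α-end≤β , β-end≤α+L) = precedes⇒disjoint (ℕ→ℚ-mono-< 0<L)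
    (subst (ℚ._≤ _) (ℕ→ℚ-+ (pos α) (len α)) (ℕ→ℚ-mono-≤ α-end≤β))
    (subst₂ ℚ._≤_ (ℕ→ℚ-+ (pos β) (len β)) (ℕ→ℚ-+ (pos α) L) (ℕ→ℚ-mono-≤ β-end≤α+L))

  apart⇒no-common-point : ∀ {α β} → 0 < L → Apart α β → ∀ c → ¬ (OnArc α c × OnArc β c)
  apart⇒no-common-point 0<L (inj₁ α≺β) c = precedes⇒no-common-point 0<L α≺β c
  apart⇒no-common-point 0<L (inj₂ β≺α) c (c∈α , c∈β) =
    precedes⇒no-common-point 0<L β≺α c (c∈β , c∈α)

  lies-within : ∀ {α t m} → t ≡ ℕ→ℚ m → pos α ≤ m → m < pos α + len α →
                ℕ→ℚ (pos α) ℚ.≤ t × t ℚ.< ℕ→ℚ (pos α) ℚ.+ ℕ→ℚ (len α)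
  lies-within {α} refl α≤m m<α-end =
    ℕ→ℚ-mono-≤ α≤m , subst (_ ℚ.<_) (ℕ→ℚ-+ (pos α) (len α)) (ℕ→ℚ-mono-< m<α-end)

  covers⇒InHalfOpenArc : ∀ {α c} → Covers α c →
                         InHalfOpenArc (ℕ→ℚ L) (ℕ→ℚ (pos α)) (ℕ→ℚ (len α)) (ℕ→ℚ c)
  covers⇒InHalfOpenArc {α} {c} (inj₁ (α≤c , c<α-end)) = + 0 , lies-within c+0L≡c α≤c c<α-end
    where
    c+0L≡c : ℕ→ℚ c ℚ.+ 0ℚ ℚ.* ℕ→ℚ L ≡ ℕ→ℚ c
    c+0L≡c = trans (cong (ℕ→ℚ c ℚ.+_) (ℚ.*-zeroˡ (ℕ→ℚ L))) (ℚ.+-identityʳ (ℕ→ℚ c))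
  covers⇒InHalfOpenArc {α} {c} (inj₂ (α≤c+L , c+L<α-end)) = + 1 , lies-within c+1L≡c+L α≤c+L c+L<α-end
    where
    c+1L≡c+L : ℕ→ℚ c ℚ.+ 1ℚ ℚ.* ℕ→ℚ L ≡ ℕ→ℚ (c + L)
    c+1L≡c+L = trans (cong (ℕ→ℚ c ℚ.+_) (ℚ.*-identityˡ (ℕ→ℚ L))) (sym (ℕ→ℚ-+ c L))

  overlap⇒common-point : ∀ {α β} → Proper α → Proper β → Overlap α β →
                         ∃ λ c → OnArc α c × OnArc β c
  overlap⇒common-point {α} {β} _ (0<β , _) (inj₁ α∋β) =
    start-within⇒common-point {ℕ→ℚ L} {ℕ→ℚ (pos β)} (covers⇒InHalfOpenArc α∋β)
      (start-within-self (ℕ→ℚ-mono-< 0<β))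
  overlap⇒common-point {α} {β} (0<α , _) _ (inj₂ β∋α) =
    let c , c∈β , c∈α = start-within⇒common-point {ℕ→ℚ L} {ℕ→ℚ (pos α)}
                          (covers⇒InHalfOpenArc β∋α) (start-within-self (ℕ→ℚ-mono-< 0<α))
    in c , c∈α , c∈β

record Layout (V : Set) : Set where
  field
    side : ℕ
    column row : V → Arc

module _ {V : Set} (layout : Layout V) (E : V → V → Set) where
  open Layout layout
  open import Data.Nat using (_<_)

  Separated Sees Hidden PairRealised : V → V → Set
  Separated u v = Apart side (column u) (column v) ⊎ Apart side (row u) (row v)
  Sees u v = Overlap side (row u) (row v) ⊎ Overlap side (column u) (column v)
  Hidden u v = Apart side (column u) (column v) × Apart side (row u) (row v)
  PairRealised u v = (E u v × Sees u v × Separated u v) ⊎ (¬ E u v × Hidden u v)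

  Realises : Set
  Realises = 0 < side × (∀ v → Proper side (column v) × Proper side (row v))
                      × (∀ u v → u ≢ v → PairRealised u v)

  realises⇒IsTRVG : Realises → IsTRVG V E
  realises⇒IsTRVG (0<side , proper , realised) =
    ℕ→ℚ side , ℕ→ℚ side , ℕ→ℚ-mono-< 0<side , ℕ→ℚ-mono-< 0<side , rect , disjoint , E⇔visible
    where
    rect : V → Rect (ℕ→ℚ side) (ℕ→ℚ side)
    rect v = record
      { x = ℕ→ℚ (pos (column v)) ; w = ℕ→ℚ (len (column v))
      ; y = ℕ→ℚ (pos (row v)) ; h = ℕ→ℚ (len (row v))
      ; 0<w = ℕ→ℚ-mono-< (proj₁ (proj₁ (proper v))) ; w<W = ℕ→ℚ-mono-< (proj₂ (proj₁ (proper v)))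
      ; 0<h = ℕ→ℚ-mono-< (proj₁ (proj₂ (proper v))) ; h<H = ℕ→ℚ-mono-< (proj₂ (proj₂ (proper v)))
      }
    separated⇒disjoint : ∀ {u v} → Separated u v → DisjointInteriors (rect u) (rect v)
    separated⇒disjoint (inj₁ columns) c _ ((c∈u , _) , (c∈v , _)) =
      apart⇒no-common-point side 0<side columns c (c∈u , c∈v)
    separated⇒disjoint (inj₂ rows) _ d ((_ , d∈u) , (_ , d∈v)) =
      apart⇒no-common-point side 0<side rows d (d∈u , d∈v)
    sees⇒visible : ∀ {u v} → Sees u v → Visible (rect u) (rect v)
    sees⇒visible {u} {v} (inj₁ rows) =
      inj₁ (overlap⇒common-point side (proj₂ (proper u)) (proj₂ (proper v)) rows)
    sees⇒visible {u} {v} (inj₂ columns) =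
      inj₂ (overlap⇒common-point side (proj₁ (proper u)) (proj₁ (proper v)) columns)
    hidden⇒invisible : ∀ {u v} → Hidden u v → ¬ Visible (rect u) (rect v)
    hidden⇒invisible (_ , rows) (inj₁ (d , d∈u , d∈v)) =
      apart⇒no-common-point side 0<side rows d (d∈u , d∈v)
    hidden⇒invisible (columns , _) (inj₂ (c , c∈u , c∈v)) =
      apart⇒no-common-point side 0<side columns c (c∈u , c∈v)
    disjoint : ∀ u v → u ≢ v → DisjointInteriors (rect u) (rect v)
    disjoint u v u≢v with realised u v u≢v
    ... | inj₁ (_ , _ , separated) = separated⇒disjoint separated
    ... | inj₂ (_ , columns , _) = separated⇒disjoint (inj₁ columns)
    E⇔visible : ∀ u v → u ≢ v → E u v ⇔ Visible (rect u) (rect v)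
    E⇔visible u v u≢v with realised u v u≢v
    ... | inj₁ (adjacent , sees , _) = mk⇔ (λ _ → sees⇒visible sees) (λ _ → adjacent)
    ... | inj₂ (¬adjacent , hidden) = mk⇔ (⊥-elim ∘ ¬adjacent) (⊥-elim ∘ hidden⇒invisible hidden)

  realises? : DecidableEquality V → (∀ {P : V → Set} → (∀ v → Dec (P v)) → Dec (∀ v → P v)) →
              Decidable E → Dec Realises
  realises? _≟_ all? E? =
    (0 <? side) ×-dec all? (λ v → proper? side (column v) ×-dec proper? side (row v)) ×-dec
    all? (λ u → all? (λ v → ¬? (u ≟ v) →-dec pairRealised? u v))
    where
    open import Data.Nat.Properties using (_<?_)
    pairRealised? : ∀ u v → Dec (PairRealised u v)
    pairRealised? u v =
      (E? u v ×-dec ((overlap? side (row u) (row v) ⊎-dec overlap? side (column u) (column v)) ×-dec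
                     (apart? side (column u) (column v) ⊎-dec apart? side (row u) (row v))))
      ⊎-dec (¬? (E? u v) ×-dec (apart? side (column u) (column v) ×-dec apart? side (row u) (row v)))

module _ {p q : ℕ} where

  KAdj? : Decidable (KAdj p q)
  KAdj? (inj₁ _) (inj₁ _) = no λ ()
  KAdj? (inj₁ _) (inj₂ _) = yes tt
  KAdj? (inj₂ _) (inj₁ _) = yes tt
  KAdj? (inj₂ _) (inj₂ _) = no λ ()

  all⊎? : ∀ {P : Fin p ⊎ Fin q → Set} → (∀ v → Dec (P v)) → Dec (∀ v → P v)
  all⊎? P? = map′ (λ (on-left , on-right) → [ on-left , on-right ]) (λ all → all ∘ inj₁ , all ∘ inj₂)
    (Fin.all? (P? ∘ inj₁) ×-dec Fin.all? (P? ∘ inj₂))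

  K-realises? : (layout : Layout (Fin p ⊎ Fin q)) → Dec (Realises layout (KAdj p q))
  K-realises? layout = realises? layout (KAdj p q) (Sum.≡-dec Fin._≟_ Fin._≟_) all⊎? KAdj?

open import Data.Nat using (_*_; _+_)

layout₃,₆ : Layout (Fin 3 ⊎ Fin 6)
layout₃,₆ = record
  { side = 24
  ; column = [ (λ i → arc (8 * toℕ i + 1) 8) , (λ j → arc (4 * toℕ j) 3) ]
  ; row = [ row-A , (λ j → arc (4 * toℕ j) 3) ]
  }
  where
  row-A : Fin 3 → Arc
  row-A zero = arc 13 8
  row-A (suc zero) = arc 21 8
  row-A (suc (suc zero)) = arc 5 8

K₃,₆ : K 3 6
K₃,₆ = realises⇒IsTRVG layout₃,₆ (KAdj 3 6) (from-yes (K-realises? layout₃,₆))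

layout₄,₄ : Layout (Fin 4 ⊎ Fin 4)
layout₄,₄ = record
  { side = 16
  ; column = [ (λ i → arc (4 * toℕ i + 1) 4) , (λ j → arc (4 * toℕ j) 3) ]
  ; row = [ row-A , (λ j → arc (4 * toℕ j) 3) ]
  }
  where
  row-A : Fin 4 → Arc
  row-A zero = arc 9 4
  row-A (suc zero) = arc 13 4
  row-A (suc (suc zero)) = arc 1 4
  row-A (suc (suc (suc zero))) = arc 5 4

K₄,₄ : K 4 4
K₄,₄ = realises⇒IsTRVG layout₄,₄ (KAdj 4 4) (from-yes (K-realises? layout₄,₄))

module _ (n : ℕ) where
  open import Data.Nat using (_<_)
  open import Data.Nat.Properties using (<-cmp)
  open import Relation.Binary.Definitions using (tri<; tri≈; tri>)

  cell : ℕ → Arc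
  cell a = arc a 1

  layout₂ : Layout (Fin 2 ⊎ Fin n)
  layout₂ = record { side = suc n ; column = column₂ ; row = row₂ }
    where
    column₂ row₂ : Fin 2 ⊎ Fin n → Arc
    column₂ (inj₁ zero) = arc 0 n
    column₂ (inj₁ (suc _)) = cell n
    column₂ (inj₂ j) = cell (toℕ j)
    row₂ (inj₁ zero) = cell n
    row₂ (inj₁ (suc _)) = arc 0 n
    row₂ (inj₂ j) = cell (toℕ j)

  bar-precedes-cell : Precedes (suc n) (arc 0 n) (cell n)
  bar-precedes-cell = ℕ.≤-refl , ℕ.≤-reflexive (ℕ.+-comm n 1)

  cell-precedes-cell : ∀ {a b} → a < b → b ≤ n → Precedes (suc n) (cell a) (cell b)
  cell-precedes-cell {a} {b} a<b b≤n =
    subst (_≤ b) (ℕ.+-comm 1 a) a<b ,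
    ℕ.≤-trans (ℕ.≤-reflexive (ℕ.+-comm b 1)) (ℕ.≤-trans (s≤s b≤n) (ℕ.m≤n+m (suc n) a))

  cells-apart : ∀ {i j : Fin n} → i ≢ j → Apart (suc n) (cell (toℕ i)) (cell (toℕ j))
  cells-apart {i} {j} i≢j with <-cmp (toℕ i) (toℕ j)
  ... | tri< i<j _ _ = inj₁ (cell-precedes-cell i<j (ℕ.<⇒≤ (Fin.toℕ<n j)))
  ... | tri≈ _ i≡j _ = ⊥-elim (i≢j (Fin.toℕ-injective i≡j))
  ... | tri> _ _ j<i = inj₂ (cell-precedes-cell j<i (ℕ.<⇒≤ (Fin.toℕ<n i)))

  cell-precedes-last : ∀ (j : Fin n) → Precedes (suc n) (cell (toℕ j)) (cell n)
  cell-precedes-last j = cell-precedes-cell (Fin.toℕ<n j) ℕ.≤-refl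

  bar-covers-cell : ∀ (j : Fin n) → Covers (suc n) (arc 0 n) (toℕ j)
  bar-covers-cell j = inj₁ (z≤n , Fin.toℕ<n j)

  layout₂-realises : 1 ≤ n → Realises layout₂ (KAdj 2 n)
  layout₂-realises 1≤n = s≤s z≤n , proper , realised
    where
    proper-cell : ∀ a → Proper (suc n) (cell a)
    proper-cell _ = s≤s z≤n , s≤s 1≤n
    proper-bar : Proper (suc n) (arc 0 n)
    proper-bar = 1≤n , ℕ.n<1+n n
    proper : ∀ v → Proper (suc n) (Layout.column layout₂ v) × Proper (suc n) (Layout.row layout₂ v)
    proper (inj₁ zero) = proper-bar , proper-cell n
    proper (inj₁ (suc zero)) = proper-cell n , proper-bar
    proper (inj₂ j) = proper-cell (toℕ j) , proper-cell (toℕ j)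
    realised : ∀ u v → u ≢ v → PairRealised layout₂ (KAdj 2 n) u v
    realised (inj₁ zero) (inj₁ zero) u≢v = ⊥-elim (u≢v refl)
    realised (inj₁ zero) (inj₁ (suc zero)) _ =
      inj₂ ((λ ()) , inj₁ bar-precedes-cell , inj₂ bar-precedes-cell)
    realised (inj₁ (suc zero)) (inj₁ zero) _ =
      inj₂ ((λ ()) , inj₂ bar-precedes-cell , inj₁ bar-precedes-cell)
    realised (inj₁ (suc zero)) (inj₁ (suc zero)) u≢v = ⊥-elim (u≢v refl)
    realised (inj₁ zero) (inj₂ j) _ =
      inj₁ (tt , inj₂ (inj₁ (bar-covers-cell j)) , inj₂ (inj₂ (cell-precedes-last j)))
    realised (inj₂ j) (inj₁ zero) _ =
      inj₁ (tt , inj₂ (inj₂ (bar-covers-cell j)) , inj₂ (inj₁ (cell-precedes-last j)))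
    realised (inj₁ (suc zero)) (inj₂ j) _ =
      inj₁ (tt , inj₁ (inj₁ (bar-covers-cell j)) , inj₁ (inj₂ (cell-precedes-last j)))
    realised (inj₂ j) (inj₁ (suc zero)) _ =
      inj₁ (tt , inj₁ (inj₂ (bar-covers-cell j)) , inj₁ (inj₁ (cell-precedes-last j)))
    realised (inj₂ i) (inj₂ j) i≢j =
      inj₂ ((λ ()) , cells-apart (i≢j ∘ cong inj₂) , cells-apart (i≢j ∘ cong inj₂))

  K₂ : 1 ≤ n → K 2 n
  K₂ = realises⇒IsTRVG layout₂ (KAdj 2 n) ∘ layout₂-realises

admissible⇒K : ∀ {p q} → 1 ≤ p → p ≤ q → Admissible p q → K p q
admissible⇒K 1≤p p≤q (inj₁ p≤2) = K-mono p≤2 ℕ.≤-refl (K₂ _ (ℕ.≤-trans 1≤p p≤q))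
admissible⇒K _ _ (inj₂ (inj₁ (refl , refl))) = K-mono ℕ.≤-refl (ℕ.m≤m+n 3 3) K₃,₆
admissible⇒K _ _ (inj₂ (inj₂ (inj₁ (refl , refl)))) = K-mono ℕ.≤-refl (ℕ.m≤m+n 4 2) K₃,₆
admissible⇒K _ _ (inj₂ (inj₂ (inj₂ (inj₁ (refl , refl))))) = K-mono ℕ.≤-refl (ℕ.m≤m+n 5 1) K₃,₆
admissible⇒K _ _ (inj₂ (inj₂ (inj₂ (inj₂ (inj₁ (refl , refl)))))) = K₃,₆
admissible⇒K _ _ (inj₂ (inj₂ (inj₂ (inj₂ (inj₂ (refl , refl)))))) = K₄,₄

theorem1p5 : (p q : ℕ) → 1 ≤ p → p ≤ q →
    (K p q ⇔ (p ≤ 2 ⊎ (p ≡ 3 × q ≡ 3) ⊎ (p ≡ 3 × q ≡ 4) ⊎ (p ≡ 3 × q ≡ 5)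
                     ⊎ (p ≡ 3 × q ≡ 6) ⊎ (p ≡ 4 × q ≡ 4)))
theorem1p5 p q 1≤p p≤q = mk⇔
  (excess-bound⇒admissible 1≤p p≤q ∘ excess-bound p q ∘ K⇒biclique-bound)
  (admissible⇒K 1≤p p≤q)
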